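{- Let $m$ be an odd positive integer, and let $\ell=\lceil\log_2 m\rceil$. Suppose $m=2^Lh+1$, where $L$ and $h$ are integers with $L\geq 3$ and $h$ odd. Then $\mathfrak K(m)<\left(1+\frac{2^{L+1}+4}{m}\right)2^\ell$.
   Context: The Thue-Morse word is the infinite binary word ${\bf t}={\bf t}_1{\bf t}_2{\bf t}_3\cdots$, where ${\bf t}_i\in\{0,1\}$ has the same parity as the number of $1$'s in the binary expansion of $i-1$. A $k$-anti-power is a word of the form $w_1w_2\cdots w_k$ where $w_1,\ldots,w_k$ are pairwise distinct words all of the same length. For a positive integer $m$, $\mathfrak K(m)$ denotes the smallest positive integer $k$ such that the prefix of ${\bf t}$ of length $km$ is not a $k$-anti-power. -}

module Defs where

open import Data.Bool using (Bool; true; false; not)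
open import Data.Nat using (ℕ; zero; suc; _+_; _*_; _<_; _≤_)
open import Data.Nat.DivMod using (_/_; _%_)
open import Data.Fin using (Fin; toℕ)
open import Data.Vec using (Vec; tabulate)
open import Relation.Binary.PropositionalEquality using (_≡_)
open import Relation.Nullary using (¬_)
open import Data.Product using (_×_)

bitParityAux : ℕ → ℕ → Bool
bitParityAux zero    n = false
bitParityAux (suc f) zero = false
bitParityAux (suc f) n@(suc _) with n % 2
... | 0 = bitParityAux f (n / 2)
... | _ = not (bitParityAux f (n / 2))

bitParity : ℕ → Bool
bitParity n = bitParityAux (suc n) n

-- Thue–Morse word, 0-indexed: tm n = t_{n+1}; true stands for the letter 1.
-- t_{n+1} has the parity of the number of 1s in the binary expansion of n.
tm : ℕ → Bool
tm n = bitParity n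

block : (m : ℕ) → ℕ → Vec Bool m
block m j = tabulate {n = m} (λ (i : Fin m) → tm (j * m + toℕ i))

IsAntiPowerPrefix : ℕ → ℕ → Set
IsAntiPowerPrefix k m = ∀ i j → i < k → j < k → ¬ i ≡ j → ¬ block m i ≡ block m j

IsFrakK : ℕ → ℕ → Set
IsFrakK m K =
  1 ≤ K × ¬ IsAntiPowerPrefix K m ×
  (∀ k → 1 ≤ k → k < K → IsAntiPowerPrefix k m)

Odd : ℕ → Set
Odd n = n % 2 ≡ 1

-- Thue–Morse satisfies t(2^k q + w) = t(q) xor t(w) for w < 2^k, so a coincidence
-- t(q) = t(q + m) spreads to the whole dyadic block [2^ℓ q, 2^ℓ (q + 1)), shifted by 2^ℓ m.
-- For m = 2^L h + 1 with h odd pick c ≤ 2 with t(c) ≠ t(c + h); then q = 2^L c + 2 and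
-- q + 1 both satisfy t(q) = t(q + m), because t flips between positions 2, 3 and 4.
-- Hence, for 2^ℓ > m, all positions in [2^ℓ q, 2^ℓ (q + 2)) agree with their shift by
-- 2^ℓ m, and this interval contains a whole block of length m, say block i; so blocks
-- i and i + 2^ℓ coincide, giving 𝔎(m) ≤ i + 2^ℓ + 1 with i m ≤ 2^ℓ (2^L c + 3).
module Submission where

open import Defs
open import Data.Bool using (Bool; true; false; not; _xor_)
open import Data.Bool.Properties using (¬-not; not-¬; xor-identityʳ; not-distribʳ-xor)
import Data.Bool.Properties as Bool
open import Data.Empty using (⊥-elim)
open import Data.Fin using (toℕ)
open import Data.Fin.Properties using (toℕ<n)
open import Data.Nat
open import Data.Nat.Divisibility using (divides)
open import Data.Nat.DivMod
open import Data.Nat.Logarithm using (⌈log₂_⌉)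
open import Data.Nat.Logarithm.Core using (⌈log2⌉)
open import Data.Nat.Properties
open import Data.Nat.Tactic.RingSolver using (solve-∀)
open import Data.Product using (Σ; ∃; ∃₂; _×_; _,_)
open import Data.Sum using (_⊎_; inj₁; inj₂)
open import Function using (_∘_)
open import Data.Vec.Properties using (tabulate-cong; ≡-dec)
open import Induction.WellFounded using (Acc; acc)
open import Relation.Binary using (tri<; tri≈; tri>)
open import Relation.Binary.PropositionalEquality
open import Relation.Nullary using (¬_; yes; no)
open import Relation.Unary using (Pred; Decidable)

[1+k]/2<1+k : ∀ k → suc k / 2 < suc k
[1+k]/2<1+k k = m/n<m (suc k) 2 (s≤s (s≤s z≤n))

bitParityAux-fuel-irrelevant : ∀ f g n → n < f → n < g →
                               bitParityAux f n ≡ bitParityAux g n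
bitParityAux-fuel-irrelevant (suc f) (suc g) zero    _         _         = refl
bitParityAux-fuel-irrelevant (suc f) (suc g) (suc k) (s≤s k<f) (s≤s k<g) with suc k % 2
... | zero  = bitParityAux-fuel-irrelevant f g (suc k / 2) (≤-trans ([1+k]/2<1+k k) k<f) (≤-trans ([1+k]/2<1+k k) k<g)
... | suc _ = cong not (bitParityAux-fuel-irrelevant f g (suc k / 2) (≤-trans ([1+k]/2<1+k k) k<f) (≤-trans ([1+k]/2<1+k k) k<g))

bitParityAux-even : ∀ f n .{{_ : NonZero n}} → n % 2 ≡ 0 →
                    bitParityAux (suc f) n ≡ bitParityAux f (n / 2)
bitParityAux-even f (suc k) even rewrite even = refl

bitParityAux-odd : ∀ f n → n % 2 ≡ 1 → bitParityAux (suc f) n ≡ not (bitParityAux f (n / 2))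
bitParityAux-odd f (suc k) odd rewrite odd = refl

[2*n]%2≡0 : ∀ n → 2 * n % 2 ≡ 0
[2*n]%2≡0 n rewrite *-comm 2 n = m*n%n≡0 n 2

[2*n]/2≡n : ∀ n → 2 * n / 2 ≡ n
[2*n]/2≡n n rewrite *-comm 2 n = m*n/n≡m n 2

[1+2*n]%2≡1 : ∀ n → suc (2 * n) % 2 ≡ 1
[1+2*n]%2≡1 n rewrite *-comm 2 n = [m+kn]%n≡m%n 1 n 2

[1+2*n]/2≡n : ∀ n → suc (2 * n) / 2 ≡ n
[1+2*n]/2≡n n = trans (+-distrib-/-∣ʳ 1 (divides n (*-comm 2 n))) ([2*n]/2≡n n)

tm-double : ∀ n → tm (2 * n) ≡ tm n
tm-double zero      = refl
tm-double n@(suc _) = begin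
  bitParityAux (suc (2 * n)) (2 * n)     ≡⟨ bitParityAux-even (2 * n) (2 * n) ([2*n]%2≡0 n) ⟩
  bitParityAux (2 * n) (2 * n / 2)       ≡⟨ cong (bitParityAux (2 * n)) ([2*n]/2≡n n) ⟩
  bitParityAux (2 * n) n                 ≡⟨ bitParityAux-fuel-irrelevant (2 * n) (suc n) n (m<m+n n z<s) ≤-refl ⟩
  tm n                                   ∎
  where open ≡-Reasoning

tm-double+1 : ∀ n → tm (suc (2 * n)) ≡ not (tm n)
tm-double+1 n = begin
  bitParityAux (suc (suc (2 * n))) (suc (2 * n))  ≡⟨ bitParityAux-odd (suc (2 * n)) (suc (2 * n)) ([1+2*n]%2≡1 n) ⟩
  not (bitParityAux (suc (2 * n)) (suc (2 * n) / 2)) ≡⟨ cong (not ∘ bitParityAux (suc (2 * n))) ([1+2*n]/2≡n n) ⟩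
  not (bitParityAux (suc (2 * n)) n)                ≡⟨ cong not (bitParityAux-fuel-irrelevant (suc (2 * n)) (suc n) n (s≤s (m≤m+n n (n + 0))) ≤-refl) ⟩
  not (tm n)                                        ∎
  where open ≡-Reasoning

even-or-odd : ∀ n → ∃ λ k → n ≡ 2 * k ⊎ n ≡ suc (2 * k)
even-or-odd zero = 0 , inj₁ refl
even-or-odd (suc n) with even-or-odd n
... | k , inj₁ refl = k , inj₂ refl
... | k , inj₂ refl = suc k , inj₁ (cong suc (sym (+-suc k (k + 0))))

odd⇒≡1+2* : ∀ {n} → Odd n → ∃ λ k → n ≡ suc (2 * k)
odd⇒≡1+2* {n} odd with even-or-odd n
... | k , inj₁ refl = ⊥-elim (0≢1+n (trans (sym ([2*n]%2≡0 k)) odd))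
... | k , inj₂ n≡1+2k = k , n≡1+2k

tm-concat : ∀ k q {w} → w < 2 ^ k → tm (2 ^ k * q + w) ≡ tm q xor tm w
tm-concat zero    q {zero} _ rewrite +-identityʳ q | +-identityʳ q = sym (xor-identityʳ (tm q))
tm-concat zero    q {suc w} (s≤s ())
tm-concat (suc k) q {w} w<2^1+k with even-or-odd w
... | v , inj₁ refl = begin
  tm (2 * 2 ^ k * q + 2 * v)  ≡⟨ cong tm (shape (2 ^ k) q v) ⟩
  tm (2 * (2 ^ k * q + v))    ≡⟨ tm-double (2 ^ k * q + v) ⟩
  tm (2 ^ k * q + v)          ≡⟨ tm-concat k q (*-cancelˡ-< 2 v (2 ^ k) w<2^1+k) ⟩
  tm q xor tm v               ≡⟨ cong (tm q xor_) (tm-double v) ⟨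
  tm q xor tm (2 * v)         ∎
  where
  open ≡-Reasoning
  shape : ∀ P q v → 2 * P * q + 2 * v ≡ 2 * (P * q + v)
  shape = solve-∀
... | v , inj₂ refl = begin
  tm (2 * 2 ^ k * q + suc (2 * v))  ≡⟨ cong tm (shape (2 ^ k) q v) ⟩
  tm (suc (2 * (2 ^ k * q + v)))    ≡⟨ tm-double+1 (2 ^ k * q + v) ⟩
  not (tm (2 ^ k * q + v))          ≡⟨ cong not (tm-concat k q (*-cancelˡ-< 2 v (2 ^ k) (<-trans (n<1+n _) w<2^1+k))) ⟩
  not (tm q xor tm v)               ≡⟨ not-distribʳ-xor (tm q) (tm v) ⟩
  tm q xor not (tm v)               ≡⟨ cong (tm q xor_) (tm-double+1 v) ⟨
  tm q xor tm (suc (2 * v))         ∎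
  where
  open ≡-Reasoning
  shape : ∀ P q v → 2 * P * q + suc (2 * v) ≡ suc (2 * (P * q + v))
  shape = solve-∀

xor-≢ : ∀ {a b x y : Bool} → a ≢ b → x ≢ y → a xor x ≡ b xor y
xor-≢ {b = b} {y = y} a≢b x≢y = trans (cong₂ _xor_ (¬-not a≢b) (¬-not x≢y)) (not-xor-not b y)
  where
  not-xor-not : ∀ b y → not b xor not y ≡ b xor y
  not-xor-not true  y = refl
  not-xor-not false y = Bool.not-involutive y

-- The shift by 2^L h + 1 sends 2^L c + w to 2^L (c + h) + (1 + w), so the flip of tm
-- between w and 1 + w cancels the one between c and c + h.
tm-period : ∀ L {c h w} → suc w < 2 ^ L → tm c ≢ tm (c + h) → tm w ≢ tm (suc w) →
            tm (2 ^ L * c + w) ≡ tm (2 ^ L * c + w + (2 ^ L * h + 1))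
tm-period L {c} {h} {w} 1+w<2^L c-flip w-flip = begin
  tm (2 ^ L * c + w)                ≡⟨ tm-concat L c (<-trans (n<1+n w) 1+w<2^L) ⟩
  tm c xor tm w                     ≡⟨ xor-≢ c-flip w-flip ⟩
  tm (c + h) xor tm (suc w)         ≡⟨ tm-concat L (c + h) 1+w<2^L ⟨
  tm (2 ^ L * (c + h) + suc w)      ≡⟨ cong tm (shape (2 ^ L) c h w) ⟩
  tm (2 ^ L * c + w + (2 ^ L * h + 1)) ∎
  where
  open ≡-Reasoning
  shape : ∀ Q c h w → Q * (c + h) + suc w ≡ Q * c + w + (Q * h + 1)
  shape = solve-∀

odd-shift-flips-tm : ∀ v → ∃ λ c → c ≤ 2 × tm c ≢ tm (c + suc (2 * v))
odd-shift-flips-tm v with tm (suc (2 * v)) in tm-h | tm (suc v) in tm-1+v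
... | true  | _     = 0 , z≤n , λ eq → not-¬ refl (trans eq tm-h)
... | false | false = 1 , s≤s z≤n , λ eq →
  not-¬ refl (trans eq (trans (cong tm (sym (*-suc 2 v))) (trans (tm-double (suc v)) tm-1+v)))
... | false | true  = 2 , s≤s (s≤s z≤n) , λ eq →
  not-¬ refl (trans eq (trans (cong (tm ∘ suc) (sym (*-suc 2 v))) (trans (tm-double+1 (suc v)) (cong not tm-1+v))))

tm-shift-dyadic : ∀ ℓ {q d p} → tm q ≡ tm (q + d) →
                  2 ^ ℓ * q ≤ p → p < 2 ^ ℓ * suc q → tm p ≡ tm (p + 2 ^ ℓ * d)
tm-shift-dyadic ℓ {q} {d} {p} tm-q≡tm-q+d Pq≤p p<P[1+q] = begin
  tm p                          ≡⟨ cong tm p≡Pq+w ⟨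
  tm (P * q + w)                ≡⟨ tm-concat ℓ q w<P ⟩
  tm q xor tm w                 ≡⟨ cong (_xor tm w) tm-q≡tm-q+d ⟩
  tm (q + d) xor tm w           ≡⟨ tm-concat ℓ (q + d) w<P ⟨
  tm (P * (q + d) + w)          ≡⟨ cong tm (shape P q d w) ⟩
  tm (P * q + w + P * d)        ≡⟨ cong (λ x → tm (x + P * d)) p≡Pq+w ⟩
  tm (p + P * d)                ∎
  where
  open ≡-Reasoning
  P = 2 ^ ℓ
  w = p ∸ P * q
  p≡Pq+w : P * q + w ≡ p
  p≡Pq+w = m+[n∸m]≡n Pq≤p
  w<P : w < P
  w<P = +-cancelˡ-< (P * q) w P (subst₂ _<_ (sym p≡Pq+w) (trans (*-suc P q) (+-comm P (P * q))) p<P[1+q])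
  shape : ∀ P q d w → P * (q + d) + w ≡ P * q + w + P * d
  shape = solve-∀

block-≡ : ∀ m {i j} → (∀ s → s < m → tm (i * m + s) ≡ tm (j * m + s)) → block m i ≡ block m j
block-≡ m agree = tabulate-cong (λ s → agree (toℕ s) (toℕ<n s))

-- Block i = ⌊2^ℓ (q + 1) / m⌋ straddles 2^ℓ (q + 1), so it lies inside [2^ℓ q, 2^ℓ (q + 2)).
block-repeats : ∀ ℓ q m .{{_ : NonZero m}} → m ≤ 2 ^ ℓ →
                tm q ≡ tm (q + m) → tm (suc q) ≡ tm (suc q + m) →
                block m (2 ^ ℓ * suc q / m) ≡ block m (2 ^ ℓ * suc q / m + 2 ^ ℓ)
block-repeats ℓ q m m≤P periodic-q periodic-1+q = block-≡ m {i} {i + P} shift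
  where
  P = 2 ^ ℓ
  i = P * suc q / m
  im≤P[1+q] : i * m ≤ P * suc q
  im≤P[1+q] = m/n*n≤m (P * suc q) m
  P[1+q]<im+m : P * suc q < i * m + m
  P[1+q]<im+m = begin-strict
    P * suc q                     ≡⟨ m≡m%n+[m/n]*n (P * suc q) m ⟩
    P * suc q % m + i * m         <⟨ +-monoˡ-< (i * m) (m%n<n (P * suc q) m) ⟩
    m + i * m                     ≡⟨ +-comm m (i * m) ⟩
    i * m + m                     ∎
    where open ≤-Reasoning
  Pq≤im : P * q ≤ i * m
  Pq≤im = <⇒≤ (+-cancelʳ-< P (P * q) (i * m) (begin-strict
    P * q + P                     ≡⟨ trans (+-comm (P * q) P) (sym (*-suc P q)) ⟩
    P * suc q                     <⟨ P[1+q]<im+m ⟩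
    i * m + m                     ≤⟨ +-monoʳ-≤ (i * m) m≤P ⟩
    i * m + P                     ∎))
    where open ≤-Reasoning
  im+m≤P[2+q] : i * m + m ≤ P * suc (suc q)
  im+m≤P[2+q] = begin
    i * m + m                     ≤⟨ +-mono-≤ im≤P[1+q] m≤P ⟩
    P * suc q + P                 ≡⟨ trans (+-comm (P * suc q) P) (sym (*-suc P (suc q))) ⟩
    P * suc (suc q)               ∎
    where open ≤-Reasoning
  shift : ∀ s → s < m → tm (i * m + s) ≡ tm ((i + P) * m + s)
  shift s s<m = trans shifted (cong tm (shape i P m s))
    where
    shape : ∀ i P m s → i * m + s + P * m ≡ (i + P) * m + s
    shape = solve-∀
    shifted : tm (i * m + s) ≡ tm (i * m + s + P * m)
    shifted with i * m + s <? P * suc q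
    ... | yes below = tm-shift-dyadic ℓ periodic-q (≤-trans Pq≤im (m≤m+n (i * m) s)) below
    ... | no  above = tm-shift-dyadic ℓ periodic-1+q (≮⇒≥ above)
                        (<-≤-trans (+-monoʳ-< (i * m) s<m) im+m≤P[2+q])

repeat-index-bound : ∀ {i m P A} → i * m ≤ P * A → m < P → suc (i + P) * m < (m + suc A) * P
repeat-index-bound {i} {m} {P} {A} im≤PA m<P = begin-strict
  suc (i + P) * m               ≡⟨ expand i P m ⟩
  i * m + (m + P * m)           ≤⟨ +-monoˡ-≤ (m + P * m) im≤PA ⟩
  P * A + (m + P * m)           <⟨ +-monoʳ-< (P * A) (+-monoˡ-< (P * m) m<P) ⟩
  P * A + (P + P * m)           ≡⟨ collect P A m ⟩
  (m + suc A) * P               ∎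
  where
  open ≤-Reasoning
  expand : ∀ i P m → suc (i + P) * m ≡ i * m + (m + P * m)
  expand = solve-∀
  collect : ∀ P A m → P * A + (P + P * m) ≡ (m + suc A) * P
  collect = solve-∀

module _ {p} {P : Pred ℕ p} (P? : Decidable P) where

  least-below : ∀ b → ∃ (λ n → n < b × P n) → ∃ λ k → k < b × P k × (∀ {j} → j < k → ¬ P j)
  least-below (suc b) (n , n<1+b , Pn) with anyUpTo? P? b
  ... | yes witness = let k , k<b , Pk , least = least-below b witness in k , m<n⇒m<1+n k<b , Pk , least
  ... | no none with m<1+n⇒m<n∨m≡n n<1+b
  ...   | inj₁ n<b  = ⊥-elim (none (n , n<b , Pn))
  ...   | inj₂ refl = n , n<1+b , Pn , λ j<n Pj → none (_ , j<n , Pj)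

RepeatsEarlier : ℕ → ℕ → Set
RepeatsEarlier m k = ∃ λ i → i < k × block m i ≡ block m k

repeatsEarlier? : ∀ m → Decidable (RepeatsEarlier m)
repeatsEarlier? m k = anyUpTo? (λ i → ≡-dec Bool._≟_ (block m i) (block m k)) k

-- 𝔎(m) is one more than the first block index that repeats an earlier block.
frakK-≤ : ∀ m {i j} → i < j → block m i ≡ block m j → ∃ λ K → IsFrakK m K × K ≤ suc j
frakK-≤ m {i} {j} i<j repeat with least-below (repeatsEarlier? m) (suc j) (j , ≤-refl , i , i<j , repeat)
... | k , k<1+j , (i′ , i′<k , repeat′) , first = suc k , (s≤s z≤n , not-anti-power , anti-powers) , k<1+j
  where
  not-anti-power : ¬ IsAntiPowerPrefix (suc k) m
  not-anti-power anti = anti i′ k (m<n⇒m<1+n i′<k) ≤-refl (<⇒≢ i′<k) repeat′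
  anti-powers : ∀ k′ → 1 ≤ k′ → k′ < suc k → IsAntiPowerPrefix k′ m
  anti-powers k′ _ k′≤k a b a<k′ b<k′ a≢b same with <-cmp a b
  ... | tri< a<b _ _ = first (<-≤-trans b<k′ (≤-pred k′≤k)) (a , a<b , same)
  ... | tri≈ _ a≡b _ = a≢b a≡b
  ... | tri> _ _ b<a = first (<-≤-trans a<k′ (≤-pred k′≤k)) (b , b<a , sym same)

n≤2^⌈log2⌉n : ∀ n (rec : Acc _<_ n) → n ≤ 2 ^ ⌈log2⌉ n rec
n≤2^⌈log2⌉n 0             _        = z≤n
n≤2^⌈log2⌉n 1             _        = s≤s z≤n
n≤2^⌈log2⌉n (suc (suc n)) (acc rs) = begin
  2 + n                   ≤⟨ +-monoʳ-≤ 2 (≤-trans (≤-reflexive (sym (⌊n/2⌋+⌈n/2⌉≡n n))) (+-monoˡ-≤ ⌈ n /2⌉ (⌊n/2⌋≤⌈n/2⌉ n))) ⟩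
  2 + (⌈ n /2⌉ + ⌈ n /2⌉) ≡⟨ double-suc ⌈ n /2⌉ ⟩
  2 * suc ⌈ n /2⌉         ≤⟨ *-monoʳ-≤ 2 (n≤2^⌈log2⌉n (suc ⌈ n /2⌉) (rs (⌈n/2⌉<n n))) ⟩
  2 * 2 ^ ⌈log2⌉ (suc ⌈ n /2⌉) (rs (⌈n/2⌉<n n)) ∎
  where
  open ≤-Reasoning
  double-suc : ∀ c → 2 + (c + c) ≡ 2 * suc c
  double-suc = solve-∀

n≤2^⌈log₂n⌉ : ∀ n → n ≤ 2 ^ ⌈log₂ n ⌉
n≤2^⌈log₂n⌉ n = n≤2^⌈log2⌉n n _

odd⇒<2^⌈log₂⌉ : ∀ {m} → 1 < m → Odd m → m < 2 ^ ⌈log₂ m ⌉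
odd⇒<2^⌈log₂⌉ {m} 1<m odd with m≤n⇒m<n∨m≡n (n≤2^⌈log₂n⌉ m)
... | inj₁ m<2^ℓ = m<2^ℓ
... | inj₂ m≡2^ℓ = ⊥-elim (not-power ⌈log₂ m ⌉ m≡2^ℓ)
  where
  not-power : ∀ ℓ → m ≢ 2 ^ ℓ
  not-power zero    refl = <-irrefl refl 1<m
  not-power (suc ℓ) refl = 0≢1+n (trans (sym ([2*n]%2≡0 (2 ^ ℓ))) odd)

early-repeated-block : ∀ L ℓ {h c m} .{{_ : NonZero m}} → 3 ≤ L → m ≡ 2 ^ L * h + 1 → m < 2 ^ ℓ →
  c ≤ 2 → tm c ≢ tm (c + h) →
  ∃₂ λ i j → i < j × block m i ≡ block m j × suc j * m < (m + (2 ^ (L + 1) + 4)) * 2 ^ ℓ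
early-repeated-block L ℓ {h} {c} {m} 3≤L refl m<P c≤2 c-flip =
  i , i + P , m<m+n i {P} (m^n>0 2 ℓ) , block-repeats ℓ q m (<⇒≤ m<P) periodic-q periodic-1+q ,
  <-≤-trans (repeat-index-bound {i} {m} {P} {suc q} (m/n*n≤m (P * suc q) m) m<P) (*-monoˡ-≤ P (+-monoʳ-≤ m 2+q≤2^[L+1]+4))
  where
  Q = 2 ^ L
  P = 2 ^ ℓ
  q = Q * c + 2
  i = P * suc q / m
  8≤Q : 8 ≤ Q
  8≤Q = ^-monoʳ-≤ 2 3≤L
  periodic-q : tm q ≡ tm (q + m)
  periodic-q = tm-period L (≤-trans (m≤m+n 4 4) 8≤Q) c-flip λ ()
  periodic-1+q : tm (suc q) ≡ tm (suc q + m)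
  periodic-1+q = subst (λ x → tm x ≡ tm (x + m)) (+-suc (Q * c) 2)
                   (tm-period L (≤-trans (m≤m+n 5 3) 8≤Q) c-flip λ ())
  2+q≤2^[L+1]+4 : 2 + q ≤ 2 ^ (L + 1) + 4
  2+q≤2^[L+1]+4 = begin
    2 + (Q * c + 2)   ≡⟨ shape (Q * c) ⟩
    Q * c + 4         ≤⟨ +-monoˡ-≤ 4 (*-monoʳ-≤ Q c≤2) ⟩
    Q * 2 + 4         ≡⟨ cong (_+ 4) (^-distribˡ-+-* 2 L 1) ⟨
    2 ^ (L + 1) + 4   ∎
    where
    open ≤-Reasoning
    shape : ∀ x → 2 + (x + 2) ≡ x + 4
    shape = solve-∀

lemma8 : (m L h : ℕ) → 1 ≤ m → Odd m → 3 ≤ L → Odd h → m ≡ 2 ^ L * h + 1 →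
    Σ ℕ (λ K → IsFrakK m K ×
    K * m < (m + (2 ^ (L + 1) + 4)) * 2 ^ ⌈log₂ m ⌉)
lemma8 m L h 1≤m odd-m 3≤L odd-h m≡2^Lh+1
  with v , refl ← odd⇒≡1+2* {h} odd-h
  with c , c≤2 , c-flip ← odd-shift-flips-tm v
  with 1<m ← subst (1 <_) (sym m≡2^Lh+1) (+-monoˡ-< 1 (*-mono-≤ (m^n>0 2 L) (s≤s z≤n)))
  with i , j , i<j , repeat , bound ←
       early-repeated-block L ⌈log₂ m ⌉ {{>-nonZero 1≤m}} 3≤L m≡2^Lh+1 (odd⇒<2^⌈log₂⌉ 1<m odd-m) c≤2 c-flip
  with K , frakK , K≤1+j ← frakK-≤ m i<j repeat
  = K , frakK , ≤-<-trans (*-monoˡ-≤ m K≤1+j) bound
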